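{- There exist a first-order source theory $\mathcal{T}_S$, a closed first-order bridging theory $\mathcal{T}_B$ and an abstract vocabulary $\mathcal{V}_A$ (a set of relation symbols) such that the bounds of the tightest first-order $\alpha$-abstraction from $\mathcal{T}_S$ with respect to $\mathcal{T}_B$ over $\mathcal{V}_A$ are not expressible as classical first-order theories (i.e., are not logically equivalent to first-order theories over $\mathcal{V}_A$).
   Context: First-order logic without function symbols (finitely many constants and relation symbols); a theory is a finite set of first-order formulas identified with their conjunction; the bridging theory is required to consist of closed formulas; vocabularies are sets of relation symbols. Second-order logic extends this with quantifiers $\forall X,\exists X$ over relations. The tightest first-order $\alpha$-abstraction from $\mathcal{T}_S$ with respect to $\mathcal{T}_B$ over $\mathcal{V}_A$ is the pair (lower bound, upper bound) consisting of the weakest sufficient condition and the strongest necessary condition of $\mathcal{T}_S$ on $\mathcal{V}_A$ under $\mathcal{T}_B$, namely the second-order formulas $\forall\bar{R}\,(\mathcal{T}_B\rightarrow\mathcal{T}_S)$ and $\exists\bar{R}\,(\mathcal{T}_B\wedge\mathcal{T}_S)$, where $\bar{R}$ lists the relation symbols occurring in $\mathcal{T}_S$ or $\mathcal{T}_B$ but not in $\mathcal{V}_A$ (treated as second-order variables). Characteristically, the lower bound $\mathcal{T}^l$ satisfies, for every formula $C$ over $\mathcal{V}_A$, $\mathcal{T}_B\models C\rightarrow\mathcal{T}_S$ iff $\mathcal{T}_B\models C\rightarrow\mathcal{T}^l$, and the upper bound $\mathcal{T}^u$ satisfies, for every formula $D$ over $\mathcal{V}_A$, $\mathcal{T}_B\models\mathcal{T}_S\rightarrow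 D$ iff $\mathcal{T}_B\models\mathcal{T}^u\rightarrow D$. -}

module Defs where

open import Data.Nat using (ℕ; _≟_)
open import Data.Product using (Σ; _×_; _,_; proj₁; proj₂)
open import Data.Product.Properties using (≡-dec)
open import Data.Sum using (_⊎_)
open import Data.Empty using (⊥)
open import Data.Bool using (Bool; true; false; if_then_else_)
open import Data.List using (List; []; _∷_; _++_)
open import Data.List.Membership.Propositional using (_∈_; _∉_)
open import Data.List.Relation.Unary.All using (All)
open import Data.Vec using (Vec; map)
open import Relation.Nullary using (¬_; Dec; yes; no; ¬?)
open import Relation.Nullary.Decidable using (_×-dec_; ⌊_⌋)
open import Relation.Binary.PropositionalEquality using (_≡_)
open import Relation.Binary using (DecidableEquality)
open import Function.Bundles using (_⇔_)
import Data.List.Membership.DecPropositional as DecMem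

-- A relation symbol: (name , arity).
RelSym : Set
RelSym = ℕ × ℕ

arity : RelSym → ℕ
arity = proj₂

_≟R_ : DecidableEquality RelSym
_≟R_ = ≡-dec _≟_ _≟_

open DecMem _≟R_ using (_∈?_)

Vocabulary : Set
Vocabulary = List RelSym

data Term : Set where
  var : ℕ → Term
  con : ℕ → Term

data Formula : Set where
  atom  : (r : RelSym) → Vec Term (arity r) → Formula
  _≐_   : Term → Term → Formula
  ⊥'    : Formula
  ¬'_   : Formula → Formula
  _∧'_  : Formula → Formula → Formula
  _∨'_  : Formula → Formula → Formula
  _⇒'_  : Formula → Formula → Formula
  ∀'    : ℕ → Formula → Formula
  ∃'    : ℕ → Formula → Formula

-- A theory is a finite set of formulas (identified with their conjunction).
Theory : Set
Theory = List Formula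

syms : Formula → List RelSym
syms (atom r ts) = r ∷ []
syms (t ≐ u) = []
syms ⊥' = []
syms (¬' φ) = syms φ
syms (φ ∧' ψ) = syms φ ++ syms ψ
syms (φ ∨' ψ) = syms φ ++ syms ψ
syms (φ ⇒' ψ) = syms φ ++ syms ψ
syms (∀' x φ) = syms φ
syms (∃' x φ) = syms φ

symsT : Theory → List RelSym
symsT [] = []
symsT (φ ∷ T) = syms φ ++ symsT T

termVars : Term → List ℕ
termVars (var x) = x ∷ []
termVars (con c) = []

termsVars : ∀ {n} → Vec Term n → List ℕ
termsVars Vec.[] = []
termsVars (t Vec.∷ ts) = termVars t ++ termsVars ts

remove : ℕ → List ℕ → List ℕ
remove x [] = []
remove x (y ∷ ys) with x ≟ y
... | yes _ = remove x ys
... | no _ = y ∷ remove x ys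

fv : Formula → List ℕ
fv (atom r ts) = termsVars ts
fv (t ≐ u) = termVars t ++ termVars u
fv ⊥' = []
fv (¬' φ) = fv φ
fv (φ ∧' ψ) = fv φ ++ fv ψ
fv (φ ∨' ψ) = fv φ ++ fv ψ
fv (φ ⇒' ψ) = fv φ ++ fv ψ
fv (∀' x φ) = remove x (fv φ)
fv (∃' x φ) = remove x (fv φ)

ClosedTheory : Theory → Set
ClosedTheory T = All (λ φ → fv φ ≡ []) T

OverF : Vocabulary → Formula → Set
OverF V φ = All (_∈ V) (syms φ)

OverT : Vocabulary → Theory → Set
OverT V T = All (OverF V) T

-- Semantics (classical Tarskian semantics, rendered via the
-- Gödel–Gentzen negative translation so that the metatheoretic
-- connectives behave classically).

record Structure : Set₁ where
  field
    D     : Set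
    rel   : (r : RelSym) → Vec D (arity r) → Set
    const : ℕ → D
open Structure public

Env : Structure → Set
Env M = ℕ → D M

update : {A : Set} → (ℕ → A) → ℕ → A → ℕ → A
update e x d y with x ≟ y
... | yes _ = d
... | no _ = e y

evalT : (M : Structure) → Env M → Term → D M
evalT M e (var x) = e x
evalT M e (con c) = const M c

Sat : (M : Structure) → Env M → Formula → Set
Sat M e (atom r ts) = ¬ ¬ rel M r (map (evalT M e) ts)
Sat M e (t ≐ u) = ¬ ¬ (evalT M e t ≡ evalT M e u)
Sat M e ⊥' = ⊥
Sat M e (¬' φ) = ¬ Sat M e φ
Sat M e (φ ∧' ψ) = Sat M e φ × Sat M e ψ
Sat M e (φ ∨' ψ) = ¬ (¬ Sat M e φ × ¬ Sat M e ψ)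
Sat M e (φ ⇒' ψ) = Sat M e φ → Sat M e ψ
Sat M e (∀' x φ) = (d : D M) → Sat M (update e x d) φ
Sat M e (∃' x φ) = ¬ ((d : D M) → ¬ Sat M (update e x d) φ)

SatT : (M : Structure) → Env M → Theory → Set
SatT M e [] = Data.Unit.⊤ where import Data.Unit
SatT M e (φ ∷ T) = Sat M e φ × SatT M e T

InRbar : Theory → Theory → Vocabulary → RelSym → Set
InRbar TS TB VA r = (r ∈ (symsT TS ++ symsT TB)) × (r ∉ VA)

inRbar? : (TS TB : Theory) (VA : Vocabulary) (r : RelSym) → Dec (InRbar TS TB VA r)
inRbar? TS TB VA r = (r ∈? (symsT TS ++ symsT TB)) ×-dec ¬? (r ∈? VA)

override : (TS TB : Theory) (VA : Vocabulary) (M : Structure) →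
           ((r : RelSym) → Vec (D M) (arity r) → Set) → Structure
override TS TB VA M f = record
  { D = D M
  ; rel = λ r → if ⌊ inRbar? TS TB VA r ⌋ then f r else rel M r
  ; const = const M
  }

-- Lower bound  ∀R̄ (T_B → T_S)  (weakest sufficient condition).
LowerBound : (TS TB : Theory) (VA : Vocabulary) (M : Structure) → Env M → Set₁
LowerBound TS TB VA M e =
  (f : (r : RelSym) → Vec (D M) (arity r) → Set) →
  SatT (override TS TB VA M f) e TB → SatT (override TS TB VA M f) e TS

-- Upper bound  ∃R̄ (T_B ∧ T_S)  (strongest necessary condition).
UpperBound : (TS TB : Theory) (VA : Vocabulary) (M : Structure) → Env M → Set₁
UpperBound TS TB VA M e =
  ¬ ((f : (r : RelSym) → Vec (D M) (arity r) → Set) →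
     ¬ (SatT (override TS TB VA M f) e TB × SatT (override TS TB VA M f) e TS))

FOExpressible : Vocabulary → ((M : Structure) → Env M → Set₁) → Set₁
FOExpressible VA P =
  Σ Theory λ T → OverT VA T × ((M : Structure) (e : Env M) → P M e ⇔ SatT M e T)

-- Take for T_B the theory of a strict order R without a greatest element
-- and for T_S a nullary atom Q, over the empty vocabulary.  Then
-- ∀R Q (T_B → Q) holds exactly in the finite (non-empty) domains and
-- ∃R Q (T_B ∧ Q) exactly in the infinite ones.  Neither is first-order:
-- a theory of quantifier rank n cannot tell the pure set with n + 1
-- elements from ℕ, because Duplicator wins the n-round
-- Ehrenfeucht–Fraïssé game by answering an old element with its old
-- partner and a new element with a fresh one.

{-# OPTIONS --safe #-}
module Submission where

open import Defs
open import Data.Empty using (⊥; ⊥-elim)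
open import Data.Fin as Fin using (Fin; zero; suc; toℕ)
open import Data.Fin.Properties using (any?; pigeonhole; injective⇒≤; toℕ-injective)
  renaming (_≟_ to _≟ᶠ_)
open import Data.List using ([]; _∷_)
open import Data.List.Relation.Unary.All using ([]; _∷_)
open import Data.Nat using (ℕ; zero; suc; _+_; _⊔_; _≤_; _<_; s≤s; z<s; s<s)
open import Data.Nat.Properties
  using (≤-refl; ≤-trans; m≤m+n; +-suc; <⇒≱; <-irrefl; <-trans; m⊔n≤o⇒m≤o; m⊔n≤o⇒n≤o)
  renaming (_≟_ to _≟ℕ_)
open import Data.Product using (Σ; ∃; _×_; _,_; proj₁; proj₂; map₂)
open import Data.Product.Function.NonDependent.Propositional using (_×-⇔_)
open import Data.Unit using (⊤; tt)
import Data.Vec as Vec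
import Data.Vec.Functional as Vector
open Vector using (Vector)
open import Function using (_∘_; id)
open import Function.Bundles using (_⇔_; mk⇔; Equivalence)
open import Function.Construct.Composition using (_⇔-∘_)
open import Function.Construct.Identity using (⇔-id)
open import Function.Construct.Symmetry using (⇔-sym)
open import Function.Definitions using (Injective)
open import Function.Related.TypeIsomorphisms using (¬-cong-⇔; →-cong-⇔)
open import Relation.Binary using (DecidableEquality; Transitive)
open import Relation.Binary.PropositionalEquality using (_≡_; _≢_; refl; sym; trans; cong; subst)
open import Relation.Nullary using (¬_; yes; no; ¬?; contradiction)
open import Relation.Nullary.Decidable using (decidable-stable)

private
  variable
    A B : Set
    m n : ℕ

≡-cong-⇔ : {x x′ y y′ : A} → x ≡ x′ → y ≡ y′ → (x ≡ y) ⇔ (x′ ≡ y′)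
≡-cong-⇔ refl refl = ⇔-id _

≡-comm-⇔ : {x y : A} → (x ≡ y) ⇔ (y ≡ x)
≡-comm-⇔ = mk⇔ sym sym

refl-⇔-refl : {x : A} {y : B} → (x ≡ x) ⇔ (y ≡ y)
refl-⇔-refl = mk⇔ (λ _ → refl) (λ _ → refl)

ZigZag : (A → B → Set) → Set
ZigZag R = (∀ a → ∃ (R a)) × (∀ b → ∃ λ a → R a b)

zigZag-map : {R S : A → B → Set} → (∀ {a b} → R a b → S a b) → ZigZag R → ZigZag S
zigZag-map f (forth , back) = map₂ f ∘ forth , map₂ f ∘ back

Π-cong-zigZag : {P : A → Set} {Q : B → Set} →
                ZigZag (λ a b → P a ⇔ Q b) → (∀ a → P a) ⇔ (∀ b → Q b)
Π-cong-zigZag (forth , back) = mk⇔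
  (λ ∀P b → let a , Pa⇔Qb = back b in Equivalence.to Pa⇔Qb (∀P a))
  (λ ∀Q a → let b , Pa⇔Qb = forth a in Equivalence.from Pa⇔Qb (∀Q b))


Misses : Vector A m → A → Set
Misses u a = ∀ i → u i ≢ a

AtLeast : ℕ → Set → Set
AtLeast k A = ∀ {m} → m < k → (u : Vector A m) → ∃ (Misses u)

injective⇒atLeast : {k : ℕ} → DecidableEquality A →
                    (ι : Fin k → A) → Injective _≡_ _≡_ ι → AtLeast k A
injective⇒atLeast _≟_ ι ι-inj {m} m<k u with any? (λ j → ¬? (any? (λ i → u i ≟ ι j)))
... | yes (j , ιⱼ∉u) = ι j , λ i uᵢ≡ιⱼ → ιⱼ∉u (i , uᵢ≡ιⱼ)
... | no ¬∃ = contradiction (injective⇒≤ preimage-injective) (<⇒≱ m<k)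
  where
  preimage : ∀ j → ∃ λ i → u i ≡ ι j
  preimage j = decidable-stable (any? (λ i → u i ≟ ι j)) (λ ιⱼ∉u → ¬∃ (j , ιⱼ∉u))

  preimage-injective : Injective _≡_ _≡_ (proj₁ ∘ preimage)
  preimage-injective {j} {j′} eq =
    ι-inj (trans (sym (proj₂ (preimage j))) (trans (cong u eq) (proj₂ (preimage j′))))

PartialIso : Vector A m → Vector B m → Set
PartialIso u v = ∀ i j → (u i ≡ u j) ⇔ (v i ≡ v j)

partialIso-sym : {u : Vector A m} {v : Vector B m} → PartialIso u v → PartialIso v u
partialIso-sym iso i j = ⇔-sym (iso i j)

partialIso-∷ : {u : Vector A m} {v : Vector B m} {a : A} {b : B} → PartialIso u v →
               (∀ j → (a ≡ u j) ⇔ (b ≡ v j)) → PartialIso (a Vector.∷ u) (b Vector.∷ v)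
partialIso-∷ iso new zero    zero    = refl-⇔-refl
partialIso-∷ iso new zero    (suc j) = new j
partialIso-∷ iso new (suc i) zero    = ≡-comm-⇔ ⇔-∘ (new i ⇔-∘ ≡-comm-⇔)
partialIso-∷ iso new (suc i) (suc j) = iso i j

extend : {u : Vector A m} {v : Vector B m} → DecidableEquality A → ∃ (Misses v) →
         PartialIso u v → (a : A) → ∃ λ b → PartialIso (a Vector.∷ u) (b Vector.∷ v)
extend {u = u} {v} _≟_ (b , b∉v) iso a with any? (λ i → u i ≟ a)
... | yes (i , refl) = v i , partialIso-∷ iso (iso i)
... | no a∉u = b , partialIso-∷ iso λ j →
  mk⇔ (λ a≡uⱼ → ⊥-elim (a∉u (j , sym a≡uⱼ))) (λ b≡vⱼ → ⊥-elim (b∉v j (sym b≡vⱼ)))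


quantifierRank : Formula → ℕ
quantifierRank (atom r ts) = 0
quantifierRank (t ≐ s)     = 0
quantifierRank ⊥'          = 0
quantifierRank (¬' φ)      = quantifierRank φ
quantifierRank (φ ∧' ψ)    = quantifierRank φ ⊔ quantifierRank ψ
quantifierRank (φ ∨' ψ)    = quantifierRank φ ⊔ quantifierRank ψ
quantifierRank (φ ⇒' ψ)    = quantifierRank φ ⊔ quantifierRank ψ
quantifierRank (∀' x φ)    = suc (quantifierRank φ)
quantifierRank (∃' x φ)    = suc (quantifierRank φ)

theoryRank : Theory → ℕ
theoryRank []      = 0
theoryRank (φ ∷ T) = quantifierRank φ ⊔ theoryRank T

pureStructure : (A : Set) → A → Structure
pureStructure A a₀ = record { D = A ; rel = λ _ _ → ⊤ ; const = λ _ → a₀ }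

module Transfer
  (_≟ᴬ_ : DecidableEquality A) (_≟ᴮ_ : DecidableEquality B) (a₀ : A) (b₀ : B)
  {K : ℕ} (atLeastᴬ : AtLeast K A) (atLeastᴮ : AtLeast K B)
  where

  𝔄 𝔅 : Structure
  𝔄 = pureStructure A a₀
  𝔅 = pureStructure B b₀

  private
    variable
      r : ℕ
      e₁ : Env 𝔄
      e₂ : Env 𝔅

  Covers : Vector A m → Vector B m → Env 𝔄 → Env 𝔅 → Set
  Covers u v e₁ e₂ = ∀ t → ∃ λ i → u i ≡ evalT 𝔄 e₁ t × v i ≡ evalT 𝔅 e₂ t

  covers-update : {u : Vector A m} {v : Vector B m} → Covers u v e₁ e₂ → ∀ x a b →
                  Covers (a Vector.∷ u) (b Vector.∷ v) (update e₁ x a) (update e₂ x b)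
  covers-update cov x a b (var y) with x ≟ℕ y
  ... | yes _ = zero , refl , refl
  ... | no _  = let i , p = cov (var y) in suc i , p
  covers-update cov x a b (con c) = let i , p = cov (con c) in suc i , p

  -- A position of the Ehrenfeucht–Fraïssé game with r rounds left; the budget
  -- guarantees fresh elements for every remaining round.
  record Position (r : ℕ) (e₁ : Env 𝔄) (e₂ : Env 𝔅) : Set where
    field
      size       : ℕ
      left       : Vector A size
      right      : Vector B size
      budget     : size + r ≤ K
      partialIso : PartialIso left right
      covers     : Covers left right e₁ e₂

  initialPosition : r < K → Position r (λ _ → a₀) (λ _ → b₀)
  initialPosition r<K = record
    { size       = 1
    ; left       = λ _ → a₀
    ; right      = λ _ → b₀
    ; budget     = r<K
    ; partialIso = λ _ _ → refl-⇔-refl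
    ; covers     = λ { (var x) → zero , refl , refl ; (con c) → zero , refl , refl }
    }

  nextPosition : Position (suc r) e₁ e₂ → ∀ x →
                 ZigZag (λ a b → Position r (update e₁ x a) (update e₂ x b))
  nextPosition {r} {e₁} {e₂} p x =
      (λ a → let b , iso = extend _≟ᴬ_ (atLeastᴮ size<K right) partialIso a
             in b , extended iso)
    , (λ b → let a , iso = extend _≟ᴮ_ (atLeastᴬ size<K left) (partialIso-sym partialIso) b
             in a , extended (partialIso-sym iso))
    where
    open Position p

    budget′ : suc size + r ≤ K
    budget′ = subst (_≤ K) (+-suc size r) budget

    size<K : size < K
    size<K = ≤-trans (s≤s (m≤m+n size r)) budget′

    extended : ∀ {a b} → PartialIso (a Vector.∷ left) (b Vector.∷ right) →
               Position r (update e₁ x a) (update e₂ x b)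
    extended {a} {b} iso = record
      { size = suc size ; left = a Vector.∷ left ; right = b Vector.∷ right
      ; budget = budget′ ; partialIso = iso ; covers = covers-update covers x a b }

  ≐-⇔ : Position r e₁ e₂ → ∀ t s →
        (evalT 𝔄 e₁ t ≡ evalT 𝔄 e₁ s) ⇔ (evalT 𝔅 e₂ t ≡ evalT 𝔅 e₂ s)
  ≐-⇔ p t s with Position.covers p t | Position.covers p s
  ... | i , uᵢ≡t , vᵢ≡t | j , uⱼ≡s , vⱼ≡s =
    ≡-cong-⇔ vᵢ≡t vⱼ≡s ⇔-∘ (Position.partialIso p i j ⇔-∘ ⇔-sym (≡-cong-⇔ uᵢ≡t uⱼ≡s))

  sat⇔ : ∀ φ → quantifierRank φ ≤ r → Position r e₁ e₂ → Sat 𝔄 e₁ φ ⇔ Sat 𝔅 e₂ φ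
  sat⇔ (atom _ _) _ _ = ⇔-id _
  sat⇔ (t ≐ s)    _ p = ¬-cong-⇔ (¬-cong-⇔ (≐-⇔ p t s))
  sat⇔ ⊥'         _ _ = ⇔-id _
  sat⇔ (¬' φ)   φ≤r p = ¬-cong-⇔ (sat⇔ φ φ≤r p)
  sat⇔ (φ ∧' ψ) φψ≤r p = sat⇔ φ (m⊔n≤o⇒m≤o _ _ φψ≤r) p ×-⇔ sat⇔ ψ (m⊔n≤o⇒n≤o _ _ φψ≤r) p
  sat⇔ (φ ∨' ψ) φψ≤r p = ¬-cong-⇔ (¬-cong-⇔ (sat⇔ φ (m⊔n≤o⇒m≤o _ _ φψ≤r) p)
                                ×-⇔ ¬-cong-⇔ (sat⇔ ψ (m⊔n≤o⇒n≤o _ _ φψ≤r) p))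
  sat⇔ (φ ⇒' ψ) φψ≤r p = →-cong-⇔ (sat⇔ φ (m⊔n≤o⇒m≤o _ _ φψ≤r) p) (sat⇔ ψ (m⊔n≤o⇒n≤o _ _ φψ≤r) p)
  sat⇔ (∀' x φ) (s≤s φ≤r) p = Π-cong-zigZag (zigZag-map (sat⇔ φ φ≤r) (nextPosition p x))
  sat⇔ (∃' x φ) (s≤s φ≤r) p =
    ¬-cong-⇔ (Π-cong-zigZag (zigZag-map (¬-cong-⇔ ∘ sat⇔ φ φ≤r) (nextPosition p x)))

  satT⇔ : ∀ T → theoryRank T ≤ r → Position r e₁ e₂ → SatT 𝔄 e₁ T ⇔ SatT 𝔅 e₂ T
  satT⇔ []      _     _ = ⇔-id _
  satT⇔ (φ ∷ T) φT≤r p = sat⇔ φ (m⊔n≤o⇒m≤o _ _ φT≤r) p ×-⇔ satT⇔ T (m⊔n≤o⇒n≤o _ _ φT≤r) p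

finiteStructure : ℕ → Structure
finiteStructure n = pureStructure (Fin (suc n)) zero

ℕ-structure : Structure
ℕ-structure = pureStructure ℕ 0

SatT-finite⇔SatT-ℕ : ∀ T → SatT (finiteStructure (theoryRank T)) (λ _ → zero) T
                           ⇔ SatT ℕ-structure (λ _ → 0) T
SatT-finite⇔SatT-ℕ T = satT⇔ T ≤-refl (initialPosition ≤-refl)
  where
  open Transfer _≟ᶠ_ _≟ℕ_ zero 0
    (injective⇒atLeast _≟ᶠ_ id id) (injective⇒atLeast _≟ℕ_ toℕ toℕ-injective)

Descending : (A → A → Set) → Vector A m → Set
Descending _≺_ c = ∀ {i j} → i Fin.< j → c j ≺ c i

module _ (_≺_ : A → A → Set) (≺-trans : Transitive _≺_) where

  descending-∷ : {c : Vector A (suc m)} {a : A} →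
                 Descending _≺_ c → c zero ≺ a → Descending _≺_ (a Vector.∷ c)
  descending-∷ desc c₀≺a {zero}  {suc zero}    _         = c₀≺a
  descending-∷ desc c₀≺a {zero}  {suc (suc j)} _         = ≺-trans (desc {zero} {suc j} z<s) c₀≺a
  descending-∷ desc c₀≺a {suc i} {suc j}       (s<s i<j) = desc i<j

  -- Sat is a negative translation, so successors exist only under ¬ ¬.
  serial⇒descending : (∀ a → ¬ ¬ ∃ (a ≺_)) → A →
                      ∀ m → ¬ ¬ ∃ λ (c : Vector A (suc m)) → Descending _≺_ c
  serial⇒descending serial a zero    ¬chain = ¬chain ((λ _ → a) , λ { {zero} {zero} () })
  serial⇒descending serial a (suc m) ¬chain =
    serial⇒descending serial a m λ (c , desc) →
      serial (c zero) λ (b , c₀≺b) → ¬chain (b Vector.∷ c , descending-∷ desc c₀≺b)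

  finite⇒¬serial : (ι : A → Fin n) → Injective _≡_ _≡_ ι → A →
                   (∀ a → ¬ a ≺ a) → ¬ (∀ a → ¬ ¬ ∃ (a ≺_))
  finite⇒¬serial {n = n} ι ι-inj a irrefl serial =
    serial⇒descending serial a n λ (c , desc) →
      let i , j , i<j , ιcᵢ≡ιcⱼ = pigeonhole ≤-refl (ι ∘ c)
      in irrefl (c j) (subst (c j ≺_) (ι-inj ιcᵢ≡ιcⱼ) (desc i<j))

pattern R = 0 , 2
pattern Q = 1 , 0

R⟨_,_⟩ : ℕ → ℕ → Formula
R⟨ x , y ⟩ = atom R (var x Vec.∷ var y Vec.∷ Vec.[])

unboundedStrictOrder : Theory
unboundedStrictOrder =
    ∀' 0 (∃' 1 R⟨ 0 , 1 ⟩)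
  ∷ ∀' 0 (¬' R⟨ 0 , 0 ⟩)
  ∷ ∀' 0 (∀' 1 (∀' 2 ((R⟨ 0 , 1 ⟩ ∧' R⟨ 1 , 2 ⟩) ⇒' R⟨ 0 , 2 ⟩)))
  ∷ []

justQ : Theory
justQ = atom Q Vec.[] ∷ []

unboundedStrictOrder-closed : ClosedTheory unboundedStrictOrder
unboundedStrictOrder-closed = refl ∷ refl ∷ refl ∷ []

finite⇒¬unboundedStrictOrder : (M : Structure) (e : Env M) (ι : D M → Fin n) →
                               Injective _≡_ _≡_ ι → ¬ SatT M e unboundedStrictOrder
finite⇒¬unboundedStrictOrder M e ι ι-inj (serial , irrefl , ≺-trans , _) =
  finite⇒¬serial _≺_ (λ p q → ≺-trans _ _ _ (p , q)) ι ι-inj (e 0) irrefl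
    (λ a ¬succ → serial a (λ b a≺b → ¬succ (b , a≺b)))
  where
  _≺_ : D M → D M → Set
  a ≺ b = ¬ ¬ rel M R (a Vec.∷ b Vec.∷ Vec.[])

lowerBound-finite : (M : Structure) (e : Env M) (ι : D M → Fin n) → Injective _≡_ _≡_ ι →
                    LowerBound justQ unboundedStrictOrder [] M e
lowerBound-finite M e ι ι-inj f sat =
  ⊥-elim (finite⇒¬unboundedStrictOrder (override justQ unboundedStrictOrder [] M f) e ι ι-inj sat)

¬upperBound-finite : (M : Structure) (e : Env M) (ι : D M → Fin n) → Injective _≡_ _≡_ ι →
                     ¬ UpperBound justQ unboundedStrictOrder [] M e
¬upperBound-finite M e ι ι-inj upper = upper λ f (sat , _) →
  finite⇒¬unboundedStrictOrder (override justQ unboundedStrictOrder [] M f) e ι ι-inj sat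

ℕ-interpretation : Set → (r : RelSym) → Vec.Vec ℕ (arity r) → Set
ℕ-interpretation q R (a Vec.∷ b Vec.∷ Vec.[]) = a < b
ℕ-interpretation q Q Vec.[]                    = q
ℕ-interpretation q _ _                         = ⊤

ℕ-unboundedStrictOrder : ∀ q e →
  SatT (override justQ unboundedStrictOrder [] ℕ-structure (ℕ-interpretation q)) e unboundedStrictOrder
ℕ-unboundedStrictOrder q e =
    (λ a ¬succ → ¬succ (suc a) (λ a≮1+a → a≮1+a ≤-refl))
  , (λ a ¬a<a → ¬a<a (<-irrefl refl))
  , (λ a b c (a<b , b<c) a≮c → a<b λ a<b → b<c λ b<c → a≮c (<-trans a<b b<c))
  , tt

¬lowerBound-ℕ : ∀ e → ¬ LowerBound justQ unboundedStrictOrder [] ℕ-structure e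
¬lowerBound-ℕ e lower = proj₁ (lower (ℕ-interpretation ⊥) (ℕ-unboundedStrictOrder ⊥ e)) id

upperBound-ℕ : ∀ e → UpperBound justQ unboundedStrictOrder [] ℕ-structure e
upperBound-ℕ e upper = upper (ℕ-interpretation ⊤) (ℕ-unboundedStrictOrder ⊤ e , (λ ¬⊤ → ¬⊤ tt) , tt)

-- The vocabulary of T is irrelevant: every atom holds in a pure structure.
FOExpressible⇒finite⇔ℕ : {V : Vocabulary} {P : (M : Structure) → Env M → Set₁} →
                         FOExpressible V P →
                         ∃ λ n → P (finiteStructure n) (λ _ → zero) ⇔ P ℕ-structure (λ _ → 0)
FOExpressible⇒finite⇔ℕ (T , _ , P⇔T) =
  theoryRank T , ⇔-sym (P⇔T _ _) ⇔-∘ (SatT-finite⇔SatT-ℕ T ⇔-∘ P⇔T _ _)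

proposition4 : Σ Theory λ TS → Σ Theory λ TB → Σ Vocabulary λ VA →
    ClosedTheory TB
    × ¬ FOExpressible VA (LowerBound TS TB VA)
    × ¬ FOExpressible VA (UpperBound TS TB VA)
proposition4 = justQ , unboundedStrictOrder , [] , unboundedStrictOrder-closed , lower , upper
  where
  lower : ¬ FOExpressible [] (LowerBound justQ unboundedStrictOrder [])
  lower expressible =
    let n , finite⇔ℕ = FOExpressible⇒finite⇔ℕ expressible
    in ¬lowerBound-ℕ (λ _ → 0)
         (Equivalence.to finite⇔ℕ (lowerBound-finite (finiteStructure n) (λ _ → zero) id id))

  upper : ¬ FOExpressible [] (UpperBound justQ unboundedStrictOrder [])
  upper expressible =
    let n , finite⇔ℕ = FOExpressible⇒finite⇔ℕ expressible
    in ¬upperBound-finite (finiteStructure n) (λ _ → zero) id id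
         (Equivalence.from finite⇔ℕ (upperBound-ℕ (λ _ → 0)))
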